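{- Let $A=(a_{ij})_{i,j\in V}$ be a separable skew-symmetric matrix and $\{X,Y\}$ a clan-partition of $A$. If there is $x\in X$ such that $A[V\setminus\{x\}]$ is inseparable, then $X=\{x\}$ and $Y=V\setminus\{x\}$.
   Context: Throughout, matrices have entries in a field $\mathbb{K}$ of characteristic not equal to $2$. $A[W]$ denotes the principal submatrix indexed by $W\subseteq V$. A subset $I\subseteq V$ is a clan of $A$ if for all $i,j\in I$ and $x\in V\setminus I$, $a_{xi}=a_{xj}$ and $a_{ix}=a_{jx}$. A clan-partition of $A$ is a partition of $V$ (into nonempty blocks) each block of which is a clan of $A$. A skew-symmetric matrix is separable if there is a nonempty proper subset $X\subsetneq V$ such that $X$ and $V\setminus X$ are both clans (i.e. it admits a clan-partition into two blocks); otherwise it is inseparable. -}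

module Defs where

open import Level using (Level; _⊔_; 0ℓ) renaming (suc to lsuc)
open import Algebra.Bundles using (CommutativeRing)
open import Data.Fin using (Fin)
open import Data.Nat using (ℕ)
open import Data.Product using (Σ; ∃; _×_; _,_; proj₁)
open import Data.Sum using (_⊎_)
open import Data.Empty using (⊥)
open import Relation.Nullary using (¬_)
open import Relation.Binary.PropositionalEquality using (_≡_; _≢_)

record Field (c ℓ : Level) : Set (lsuc (c ⊔ ℓ)) where
  field
    commutativeRing : CommutativeRing c ℓ
  open CommutativeRing commutativeRing public
  field
    0≉1     : ¬ (0# ≈ 1#)
    inverse : ∀ x → ¬ (x ≈ 0#) → ∃ λ y → (x * y) ≈ 1#

CharNot2 : ∀ {c ℓ} → Field c ℓ → Set ℓ
CharNot2 K = ¬ ((1# + 1#) ≈ 0#)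
  where open Field K

module MatrixDefs {c ℓ} (K : Field c ℓ) where
  open Field K

  Matrix : Set → Set c
  Matrix U = U → U → Carrier

  Subset : Set → Set₁
  Subset U = U → Set

  SkewSymmetric : ∀ {U} → Matrix U → Set ℓ
  SkewSymmetric {U} A = ∀ (i j : U) → A j i ≈ - (A i j)

  sub : ∀ {U} → Matrix U → (W : Subset U) → Matrix (Σ U W)
  sub A W i j = A (proj₁ i) (proj₁ j)

  IsClan : ∀ {U} → Matrix U → Subset U → Set ℓ
  IsClan {U} A I = ∀ (i j x : U) → I i → I j → ¬ I x →
                   (A x i ≈ A x j) × (A i x ≈ A j x)

  Nonempty : ∀ {U} → Subset U → Set
  Nonempty {U} X = ∃ λ (u : U) → X u

  IsPartition2 : ∀ {U} → Subset U → Subset U → Set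
  IsPartition2 {U} X Y =
    Nonempty X × Nonempty Y ×
    (∀ u → X u ⊎ Y u) × (∀ u → X u → Y u → ⊥)

  IsClanPartition2 : ∀ {U} → Matrix U → Subset U → Subset U → Set ℓ
  IsClanPartition2 A X Y = IsPartition2 X Y × IsClan A X × IsClan A Y

  Separable : ∀ {U} → Matrix U → Set (lsuc 0ℓ ⊔ ℓ)
  Separable {U} A = ∃ λ (X : Subset U) → ∃ λ (Y : Subset U) → IsClanPartition2 A X Y

  Inseparable : ∀ {U} → Matrix U → Set (lsuc 0ℓ ⊔ ℓ)
  Inseparable A = ¬ Separable A

  AllBut : ∀ {n} → Fin n → Subset (Fin n)
  AllBut x v = v ≢ x

module Submission where

-- Restricting a matrix to a set W of indices preserves clans:
-- if I is a clan of A then I ∩ W is a clan of A[W], because the clan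
-- conditions for A[W] are instances of those for A.  Hence a clan-partition
-- {X , Y} of A whose blocks both meet W restricts to a clan-partition of A[W],
-- i.e. A[W] is separable.  Now take W = V ∖ {x} with x ∈ X.  The block Y is
-- nonempty and avoids x, so it meets W; if X contained some v ≠ x it would
-- meet W too and A[V ∖ {x}] would be separable, contrary to hypothesis.
-- Thus X ⊆ {x}, and a set-theoretic lemma about two-block partitions turns
-- this into X = {x} and Y = V ∖ {x}.

open import Defs
open import Level using (Level)
open import Data.Nat using (ℕ)
open import Data.Fin using (Fin; _≟_)
open import Data.Product using (_×_; _,_; proj₁; Σ; ∃)
open import Data.Sum using (_⊎_; inj₁; inj₂)
open import Data.Empty using (⊥; ⊥-elim)
open import Relation.Nullary using (yes; no)
open import Relation.Binary.PropositionalEquality using (_≡_; _≢_; subst; sym)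
open import Function.Bundles using (_⇔_; mk⇔)

singletonBlock : ∀ {U : Set} (X Y : U → Set) →
  (∀ u → X u ⊎ Y u) → (∀ u → X u → Y u → ⊥) →
  (x : U) → X x → (∀ v → X v → v ≡ x) →
  (∀ v → X v ⇔ (v ≡ x)) × (∀ v → Y v ⇔ (v ≢ x))
singletonBlock X Y cover disjoint x Xx X⊆x =
  (λ v → mk⇔ (X⊆x v) (λ v≡x → subst X (sym v≡x) Xx)) ,
  (λ v → mk⇔ (λ Yv v≡x → disjoint v (subst X (sym v≡x) Xx) Yv) (outsideX v))
  where
  outsideX : ∀ v → v ≢ x → Y v
  outsideX v v≢x with cover v
  ... | inj₁ Xv = ⊥-elim (v≢x (X⊆x v Xv))
  ... | inj₂ Yv = Yv

module Restriction {c ℓ : Level} (K : Field c ℓ) where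
  open MatrixDefs K

  restrict : ∀ {U : Set} (W : Subset U) → Subset U → Subset (Σ U W)
  restrict W I p = I (proj₁ p)

  clanRestrict : ∀ {U : Set} (A : Matrix U) (W : Subset U) (I : Subset U) →
    IsClan A I → IsClan (sub A W) (restrict W I)
  clanRestrict A W I clan i j z = clan (proj₁ i) (proj₁ j) (proj₁ z)

  partitionRestrict : ∀ {U : Set} (W : Subset U) (X Y : Subset U) →
    IsPartition2 X Y → (∃ λ u → W u × X u) → (∃ λ u → W u × Y u) →
    IsPartition2 (restrict W X) (restrict W Y)
  partitionRestrict W X Y (_ , _ , cover , disjoint) (u , Wu , Xu) (v , Wv , Yv) =
    ((u , Wu) , Xu) , ((v , Wv) , Yv) ,
    (λ p → cover (proj₁ p)) , (λ p → disjoint (proj₁ p))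

  separableRestrict : ∀ {U : Set} (A : Matrix U) (W : Subset U) (X Y : Subset U) →
    IsClanPartition2 A X Y → (∃ λ u → W u × X u) → (∃ λ u → W u × Y u) →
    Separable (sub A W)
  separableRestrict A W X Y (partition , clanX , clanY) meetsX meetsY =
    restrict W X , restrict W Y ,
    partitionRestrict W X Y partition meetsX meetsY ,
    clanRestrict A W X clanX , clanRestrict A W Y clanY

lemma3 : ∀ {c ℓ : Level} (K : Field c ℓ) → CharNot2 K →
    let open MatrixDefs K in
    (n : ℕ) (A : Matrix (Fin n)) → SkewSymmetric A → Separable A →
    (X Y : Subset (Fin n)) → IsClanPartition2 A X Y →
    (x : Fin n) → X x → Inseparable (sub A (AllBut x)) →
    (∀ v → X v ⇔ (v ≡ x)) × (∀ v → Y v ⇔ (v ≢ x))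
lemma3 K _ n A _ _ X Y clanPartition@((_ , (y , Yy) , cover , disjoint) , _) x Xx inseparable =
  singletonBlock X Y cover disjoint x Xx X⊆x
  where
  open MatrixDefs K
  open Restriction K

  y≢x : y ≢ x
  y≢x y≡x = disjoint y (subst X (sym y≡x) Xx) Yy

  X⊆x : ∀ v → X v → v ≡ x
  X⊆x v Xv with v ≟ x
  ... | yes v≡x = v≡x
  ... | no v≢x = ⊥-elim (inseparable
          (separableRestrict A (AllBut x) X Y clanPartition (v , v≢x , Xv) (y , y≢x , Yy)))
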